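{- Let $H$ be a connected graph with an edge colouring that is a rainbow colouring of $H$ using at most $h$ colours, and let $P$ be an odd ear on $H$ which is assigned a balanced colouring. Then the edge colouring of $G := H \cup P$ is a rainbow colouring of $G$. Further, $rc(H \cup P) \leq h + \frac{m}{2}$, where $m = |V(H \cup P)| - |V(H)|$ is the number of new vertices added by $P$.
   Context: All graphs are finite, simple and undirected. A path is a rainbow path if no two of its edges have the same colour; an edge colouring of a connected graph is a rainbow colouring (the graph is rainbow coloured) if every pair of vertices is joined by a rainbow path; $rc(G)$ is the minimum number of colours in a rainbow colouring of $G$. For an edge-coloured graph $H$, $colours(H)$ is the set of colours used on $H$. An (open) ear on a connected graph $H$ is a path $P=(x_0,x_1,\ldots,x_m)$ with $V(P)\cap V(H)=\{x_0,x_m\}$ and $x_0\neq x_m$; its length is its number of edges, and it is odd or even according to its length; $x_0,x_m$ are its foots. Balanced colouring of an odd ear: if $P=(x_0,x_1,\ldots,x_{2k+1})$ is an odd ear on a rainbow coloured graph $H$, a balanced colouring $C$ of the edges of $P$ is given by $C(x_j,x_{j+1}) = C(x_{j+k+1},x_{j+k+2}) = c_j$ for $0 \le j \le k-1$ and $C(x_k,x_{k+1}) = c_{old}$, where $c_0,\ldots,c_{k-1}$ are distinct colours not in $colours(H)$ and $c_{old} \in colours(H)$. -}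

module Defs where

open import Data.Nat using (ℕ; zero; suc; _+_; _*_; _∸_; _≤_; _<_)
open import Data.Nat.DivMod using (_/_)
open import Data.Bool using (Bool; true; false; T)
open import Data.Fin using (Fin)
open import Data.Fin.Subset using (Subset; ∣_∣) renaming (_∈_ to _∈ˢ_; _∉_ to _∉ˢ_)
open import Data.List using (List; []; _∷_; length; map; filter; allFin; cartesianProduct; deduplicate; last)
open import Data.List.Relation.Unary.All using (All)
open import Data.List.Relation.Unary.Unique.Propositional using (Unique)
open import Data.List.Membership.Propositional using () renaming (_∈_ to _∈ᴸ_; _∉_ to _∉ᴸ_)
open import Data.Maybe using (Maybe; just)
open import Data.Product using (Σ; ∃; _×_; _,_; proj₁; proj₂)
open import Data.Sum using (_⊎_)
open import Relation.Binary.PropositionalEquality using (_≡_; _≢_)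
open import Relation.Nullary using (¬_)
open import Function.Bundles using (_⇔_)
import Data.Nat as ℕ

record Graph (N : ℕ) : Set where
  field
    V      : Subset N
    E      : Fin N → Fin N → Bool
    sym    : ∀ u v → E u v ≡ E v u
    irrefl : ∀ v → E v v ≡ false
    closed : ∀ u v → E u v ≡ true → (u ∈ˢ V) × (v ∈ˢ V)
open Graph public

Adj : ∀ {N} → Graph N → Fin N → Fin N → Set
Adj G u v = E G u v ≡ true

-- An edge colouring: colour of the edge uv; symmetric so that it is well-defined on
-- undirected edges.  Only its values on edges matter.
Colouring : ℕ → Set
Colouring N = Fin N → Fin N → ℕ

SymColouring : ∀ {N} → Colouring N → Set
SymColouring c = ∀ u v → c u v ≡ c v u

edgesOf : ∀ {N} → List (Fin N) → List (Fin N × Fin N)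
edgesOf []           = []
edgesOf (x ∷ [])     = []
edgesOf (x ∷ y ∷ xs) = (x , y) ∷ edgesOf (y ∷ xs)

IsPath : ∀ {N} → Graph N → Fin N → Fin N → List (Fin N) → Set
IsPath G u v ps =
  (Data.List.head ps ≡ just u) × (last ps ≡ just v) ×
  All (λ x → x ∈ˢ V G) ps ×
  All (λ e → Adj G (proj₁ e) (proj₂ e)) (edgesOf ps) ×
  Unique ps

Rainbow : ∀ {N} → Colouring N → List (Fin N) → Set
Rainbow c ps = Unique (map (λ e → c (proj₁ e) (proj₂ e)) (edgesOf ps))

Connected : ∀ {N} → Graph N → Set
Connected G = ∀ u v → u ∈ˢ V G → v ∈ˢ V G → ∃ λ ps → IsPath G u v ps

IsRainbowColouring : ∀ {N} → Graph N → Colouring N → Set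
IsRainbowColouring G c =
  Connected G ×
  (∀ u v → u ∈ˢ V G → v ∈ˢ V G → ∃ λ ps → IsPath G u v ps × Rainbow c ps)

colours : ∀ {N} → Graph N → Colouring N → List ℕ
colours {N} G c =
  deduplicate ℕ._≟_
    (map (λ e → c (proj₁ e) (proj₂ e))
      (filter (λ e → E G (proj₁ e) (proj₂ e) Data.Bool.≟ true)
        (cartesianProduct (allFin N) (allFin N))))

-- rc(G) ≤ r : some rainbow colouring of G uses at most r colours
-- (equivalent to min{...} ≤ r, since rc is a minimum)
RcAtMost : ∀ {N} → Graph N → ℕ → Set
RcAtMost G r = ∃ λ c → SymColouring c × IsRainbowColouring G c × length (colours G c) ≤ r

IsOddEar : ∀ {N} → Graph N → (k : ℕ) → (ℕ → Fin N) → Set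
IsOddEar H k x =
  (∀ i j → i ≤ 2 * k + 1 → j ≤ 2 * k + 1 → x i ≡ x j → i ≡ j) ×
  (x 0 ∈ˢ V H) × (x (2 * k + 1) ∈ˢ V H) ×
  (∀ i → 0 < i → i < 2 * k + 1 → x i ∉ˢ V H)

IsUnionWithPath : ∀ {N} → Graph N → Graph N → (k : ℕ) → (ℕ → Fin N) → Set
IsUnionWithPath G H k x =
  (∀ v → (v ∈ˢ V G) ⇔ ((v ∈ˢ V H) ⊎ ∃ λ i → i ≤ 2 * k + 1 × x i ≡ v)) ×
  (∀ u v → Adj G u v ⇔
     (Adj H u v ⊎ ∃ λ i → i < 2 * k + 1 ×
        (((x i ≡ u) × (x (suc i) ≡ v)) ⊎ ((x i ≡ v) × (x (suc i) ≡ u)))))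

IsBalanced : ∀ {N} → Graph N → Colouring N → (k : ℕ) → (ℕ → Fin N) → Set
IsBalanced H c k x =
  ∃ λ (cs : ℕ → ℕ) →
    (∀ i j → i < k → j < k → cs i ≡ cs j → i ≡ j) ×
    (∀ j → j < k → cs j ∉ᴸ colours H c) ×
    (∀ j → j < k → c (x j) (x (suc j)) ≡ cs j) ×
    (∀ j → j < k → c (x (j + k + 1)) (x (j + k + 2)) ≡ cs j) ×
    (c (x k) (x (suc k)) ∈ᴸ colours H c)

-- Write P = (x₀, …, x_K) with K = 2k+1 and call the edge x_t x_{t+1} edge t.  Edges t and
-- k+1+t (t < k) share the new colour c_t and edge k carries an old colour, so any k+1
-- consecutive edges of P have distinct colours.  A vertex x_i with i ≤ k therefore reaches x₀
-- rainbowly along P using only the new colours c_0, …, c_{i-1}, and symmetrically x_i with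
-- i > k reaches x_K using only c_{i-k-1}, …, c_{k-1}; since new colours never occur in H,
-- such a piece can be continued by a rainbow path of H.  Two vertices of P at distance at
-- most k+1 on P are joined along P; otherwise x_i (i < k) runs down to x₀, through H to x_K,
-- and down to x_j, the two pieces of P using the disjoint colour ranges below and above i.
-- G uses at most k colours more than H, and P has 2k new vertices.
module Submission where

open import Defs hiding (sym)
open import Data.Bool using (true)
import Data.Bool as Bool
open import Data.Empty using (⊥; ⊥-elim)
open import Data.Fin using (Fin)
open import Data.Fin.Subset using (Subset; ∣_∣; ⁅_⁆)
  renaming (_∈_ to _∈ˢ_; _∉_ to _∉ˢ_; _⊆_ to _⊆ˢ_; _∪_ to _∪ˢ_)
open import Data.Fin.Subset.Properties
  using (p⊆p∪q; x∈p∪q⁺; x∈p∪q⁻; x∈⁅x⁆; x∈⁅y⁆⇒x≡y; p⊆q⇒∣p∣≤∣q∣; p⊂q⇒∣p∣<∣q∣)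
open import Data.List
  using (List; []; _∷_; _++_; _∷ʳ_; map; length; reverse; head; last; applyUpTo; applyDownFrom; allFin; cartesianProduct)
open import Data.List.Properties
  using (map-++; length-++; length-applyUpTo; unfold-reverse; reverse-involutive; reverse-map)
open import Data.List.Membership.Propositional using (_∈_; _∉_)
open import Data.List.Membership.Propositional.Properties
  using (∈-∃++; ∈-++⁺ˡ; ∈-++⁺ʳ; ∈-++⁻; ∈-map⁺; ∈-map⁻; ∈-filter⁺; ∈-filter⁻; ∈-cartesianProduct⁺;
         ∈-allFin; ∈-deduplicate⁺; ∈-deduplicate⁻; ∈-applyUpTo⁺)
open import Data.List.Relation.Binary.Disjoint.Propositional using (Disjoint)
import Data.List.Relation.Binary.Permutation.Propositional as Perm
import Data.List.Relation.Binary.Permutation.Propositional.Properties as Perm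
import Data.List.Relation.Binary.Permutation.Setoid as PermSetoid
import Data.List.Relation.Binary.Permutation.Setoid.Properties as PermSetoid
open import Data.List.Relation.Unary.All as All using (All; _∷_)
import Data.List.Relation.Unary.All.Properties as All
open import Data.List.Relation.Unary.Any using (here; there)
open import Data.List.Relation.Unary.AllPairs using (_∷_)
open import Data.List.Relation.Unary.Unique.Propositional using (Unique)
import Data.List.Relation.Unary.Unique.Propositional.Properties as Unique
open import Data.List.Relation.Unary.Unique.DecPropositional.Properties using (deduplicate-!)
open import Data.Maybe using (just)
open import Data.Nat using (ℕ; zero; suc; _≤_; _<_; _+_; _*_; _∸_; _/_; z≤n; s≤s; z<s)
import Data.Nat as ℕ
open import Data.Nat.Properties
open import Data.Nat.DivMod using (m*n/n≡m; /-mono-≤)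
open import Data.Product using (∃; ∃₂; _×_; _,_; proj₁; proj₂; swap)
open import Data.Sum using (_⊎_; inj₁; inj₂)
open import Function.Bundles using (Equivalence)
open import Relation.Binary.Definitions using (tri<; tri≈; tri>)
open import Relation.Binary.PropositionalEquality
  using (_≡_; _≢_; refl; sym; trans; cong; cong₂; subst; subst₂; setoid; module ≡-Reasoning)
open import Relation.Nullary using (yes; no)
open import Relation.Unary using (_∪_; _∩_; _⊆_; Empty)

module _ {A : Set} where

  Unique-reverse : {xs : List A} → Unique xs → Unique (reverse xs)
  Unique-reverse {xs} =
    PermSetoid.Unique-resp-↭ (setoid A) (PermSetoid.↭-sym (setoid A) (PermSetoid.↭-reverse (setoid A) xs))

  All-reverse : {P : A → Set} {xs : List A} → All P xs → All P (reverse xs)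
  All-reverse {xs = xs} = Perm.All-resp-↭ (Perm.↭-sym (Perm.↭-reverse xs))

  All-disjoint : {P Q : A → Set} {xs ys : List A} →
                 All P xs → All Q ys → (∀ {a} → P a → Q a → ⊥) → Disjoint xs ys
  All-disjoint ps qs apart (a∈xs , a∈ys) = apart (All.lookup ps a∈xs) (All.lookup qs a∈ys)

  Unique⇒length≤ : {xs ys : List A} → Unique xs → (∀ {a} → a ∈ xs → a ∈ ys) → length xs ≤ length ys
  Unique⇒length≤ {[]}     _            _  = z≤n
  Unique⇒length≤ {a ∷ xs} (a∉xs ∷ uxs) xs⊆ys with ∈-∃++ (xs⊆ys (here refl))
  ... | ys₁ , ys₂ , refl =
    subst (suc (length xs) ≤_) (sym length-split) (s≤s (Unique⇒length≤ uxs xs⊆ys₁++ys₂))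
    where
      length-split : length (ys₁ ++ a ∷ ys₂) ≡ suc (length (ys₁ ++ ys₂))
      length-split = begin
        length (ys₁ ++ a ∷ ys₂)          ≡⟨ length-++ ys₁ ⟩
        length ys₁ + suc (length ys₂)    ≡⟨ +-suc (length ys₁) (length ys₂) ⟩
        suc (length ys₁ + length ys₂)    ≡⟨ cong suc (sym (length-++ ys₁)) ⟩
        suc (length (ys₁ ++ ys₂))        ∎
        where open ≡-Reasoning
      xs⊆ys₁++ys₂ : ∀ {b} → b ∈ xs → b ∈ ys₁ ++ ys₂
      xs⊆ys₁++ys₂ b∈xs with ∈-++⁻ ys₁ (xs⊆ys (there b∈xs))
      ... | inj₁ b∈ys₁         = ∈-++⁺ˡ b∈ys₁
      ... | inj₂ (here refl)   = ⊥-elim (All.lookup a∉xs b∈xs refl)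
      ... | inj₂ (there b∈ys₂) = ∈-++⁺ʳ ys₁ b∈ys₂

  head-++ : ∀ (xs ys : List A) {u} → head xs ≡ just u → head (xs ++ ys) ≡ just u
  head-++ (_ ∷ _) ys eq = eq

  last-++ : ∀ (xs ys : List A) {w} → last xs ≡ just w → last (xs ++ ys) ≡ last (w ∷ ys)
  last-++ (_ ∷ [])     ys refl = refl
  last-++ (_ ∷ b ∷ xs) ys eq   = last-++ (b ∷ xs) ys eq

  last-∷ʳ : ∀ (xs : List A) a → last (xs ∷ʳ a) ≡ just a
  last-∷ʳ []           a = refl
  last-∷ʳ (_ ∷ [])     a = refl
  last-∷ʳ (_ ∷ b ∷ xs) a = last-∷ʳ (b ∷ xs) a

  last-reverse : ∀ (xs : List A) → last (reverse xs) ≡ head xs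
  last-reverse []       = refl
  last-reverse (a ∷ xs) = trans (cong last (unfold-reverse a xs)) (last-∷ʳ (reverse xs) a)

  head-reverse : ∀ (xs : List A) → head (reverse xs) ≡ last xs
  head-reverse xs = trans (sym (last-reverse (reverse xs))) (cong last (reverse-involutive xs))

  last-applyDownFrom : ∀ (f : ℕ → A) n → last (applyDownFrom f (suc n)) ≡ just (f 0)
  last-applyDownFrom f zero    = refl
  last-applyDownFrom f (suc n) = last-applyDownFrom f n

module _ {N : ℕ} where

  edgesOf-++ : ∀ (P Q : List (Fin N)) {w} → last P ≡ just w →
               edgesOf (P ++ Q) ≡ edgesOf P ++ edgesOf (w ∷ Q)
  edgesOf-++ (_ ∷ [])     Q refl = refl
  edgesOf-++ (a ∷ b ∷ P) Q eq   = cong ((a , b) ∷_) (edgesOf-++ (b ∷ P) Q eq)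

  edgesOf-reverse : ∀ (P : List (Fin N)) → edgesOf (reverse P) ≡ reverse (map swap (edgesOf P))
  edgesOf-reverse []          = refl
  edgesOf-reverse (_ ∷ [])    = refl
  edgesOf-reverse (a ∷ b ∷ P) = begin
    edgesOf (reverse (a ∷ b ∷ P))                       ≡⟨ cong edgesOf (unfold-reverse a (b ∷ P)) ⟩
    edgesOf (reverse (b ∷ P) ∷ʳ a)                      ≡⟨ edgesOf-++ (reverse (b ∷ P)) (a ∷ []) (last-reverse (b ∷ P)) ⟩
    edgesOf (reverse (b ∷ P)) ∷ʳ (b , a)                ≡⟨ cong (_∷ʳ (b , a)) (edgesOf-reverse (b ∷ P)) ⟩
    reverse (map swap (edgesOf (b ∷ P))) ∷ʳ (b , a)     ≡⟨ sym (unfold-reverse (b , a) (map swap (edgesOf (b ∷ P)))) ⟩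
    reverse (map swap (edgesOf (a ∷ b ∷ P)))            ∎
    where open ≡-Reasoning

  edgesOf-applyDownFrom : ∀ (f : ℕ → Fin N) n →
                          edgesOf (applyDownFrom f (suc n)) ≡ applyDownFrom (λ t → f (suc t) , f t) n
  edgesOf-applyDownFrom f zero    = refl
  edgesOf-applyDownFrom f (suc n) = cong ((f (suc n) , f n) ∷_) (edgesOf-applyDownFrom f n)

Edge : ∀ {N} → Graph N → Fin N × Fin N → Set
Edge G e = Adj G (proj₁ e) (proj₂ e)

edgeColour : ∀ {N} → Colouring N → Fin N × Fin N → ℕ
edgeColour c e = c (proj₁ e) (proj₂ e)

pathColours : ∀ {N} → Colouring N → List (Fin N) → List ℕ
pathColours c ps = map (edgeColour c) (edgesOf ps)

RainbowPath : ∀ {N} → Graph N → Colouring N → Fin N → Fin N → List (Fin N) → Set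
RainbowPath G c u v ps = IsPath G u v ps × Rainbow c ps

module _ {N : ℕ} (c : Colouring N) where

  pathColours-++ : ∀ (P Q : List (Fin N)) {w} → last P ≡ just w →
                   pathColours c (P ++ Q) ≡ pathColours c P ++ pathColours c (w ∷ Q)
  pathColours-++ P Q last≡w =
    trans (cong (map (edgeColour c)) (edgesOf-++ P Q last≡w)) (map-++ (edgeColour c) (edgesOf P) _)

  pathColours-reverse : SymColouring c → ∀ (P : List (Fin N)) →
                        pathColours c (reverse P) ≡ reverse (pathColours c P)
  pathColours-reverse csym P = begin
    map (edgeColour c) (edgesOf (reverse P))               ≡⟨ cong (map (edgeColour c)) (edgesOf-reverse P) ⟩
    map (edgeColour c) (reverse (map swap (edgesOf P)))    ≡⟨ reverse-map (edgeColour c) (map swap (edgesOf P)) ⟩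
    reverse (map (edgeColour c) (map swap (edgesOf P)))    ≡⟨ cong reverse (swap-invariant (edgesOf P)) ⟩
    reverse (pathColours c P)                              ∎
    where
      open ≡-Reasoning
      swap-invariant : ∀ es → map (edgeColour c) (map swap es) ≡ map (edgeColour c) es
      swap-invariant []             = refl
      swap-invariant ((a , b) ∷ es) = cong₂ _∷_ (csym b a) (swap-invariant es)

  pathColours-applyDownFrom : ∀ (f : ℕ → Fin N) n →
    pathColours c (applyDownFrom f (suc n)) ≡ applyDownFrom (λ t → c (f (suc t)) (f t)) n
  pathColours-applyDownFrom f zero    = refl
  pathColours-applyDownFrom f (suc n) = cong (c (f (suc n)) (f n) ∷_) (pathColours-applyDownFrom f n)

module RainbowPaths {N : ℕ} (G : Graph N) (c : Colouring N) where

  ∈-colours⁺ : ∀ {u v} → Adj G u v → c u v ∈ colours G c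
  ∈-colours⁺ {u} {v} uv∈G =
    ∈-deduplicate⁺ ℕ._≟_ (∈-map⁺ (edgeColour c)
      (∈-filter⁺ (λ e → E G (proj₁ e) (proj₂ e) Bool.≟ true)
        (∈-cartesianProduct⁺ (∈-allFin u) (∈-allFin v)) uv∈G))

  ∈-colours⁻ : ∀ {γ} → γ ∈ colours G c → ∃₂ λ u v → Adj G u v × γ ≡ c u v
  ∈-colours⁻ γ∈ with ∈-map⁻ (edgeColour c) (∈-deduplicate⁻ ℕ._≟_ _ γ∈)
  ... | (u , v) , uv∈ , refl =
    u , v , proj₂ (∈-filter⁻ (λ e → E G (proj₁ e) (proj₂ e) Bool.≟ true)
                    {xs = cartesianProduct (allFin N) (allFin N)} uv∈) , refl

  colours-unique : Unique (colours G c)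
  colours-unique = deduplicate-! ℕ._≟_ _

  rainbowConnected⇒IsRainbowColouring :
    (∀ u v → u ∈ˢ V G → v ∈ˢ V G → ∃ (RainbowPath G c u v)) → IsRainbowColouring G c
  rainbowConnected⇒IsRainbowColouring rainbow =
    (λ u v u∈G v∈G → let ps , path , _ = rainbow u v u∈G v∈G in ps , path) , rainbow

  RainbowPath-reverse : SymColouring c → ∀ {u v} ps → RainbowPath G c u v ps → RainbowPath G c v u (reverse ps)
  RainbowPath-reverse csym ps ((head≡u , last≡v , inG , edges , unique) , rainbow) =
    ( trans (head-reverse ps) last≡v
    , trans (last-reverse ps) head≡u
    , All-reverse inG
    , subst (All (Edge G)) (sym (edgesOf-reverse ps))
        (All-reverse (All.map⁺ (All.map (λ {e} uv∈G → trans (Graph.sym G (proj₂ e) (proj₁ e)) uv∈G) edges)))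
    , Unique-reverse unique )
    , subst Unique (sym (pathColours-reverse c csym ps)) (Unique-reverse rainbow)

  ∃RainbowPath-sym : SymColouring c → ∀ {u v} → ∃ (RainbowPath G c u v) → ∃ (RainbowPath G c v u)
  ∃RainbowPath-sym csym (ps , path) = reverse ps , RainbowPath-reverse csym ps path

  applyDownFrom-isPath : ∀ (f : ℕ → Fin N) n →
    (∀ {t} → t < suc n → f t ∈ˢ V G) →
    (∀ {t} → t < n → Adj G (f (suc t)) (f t)) →
    (∀ {s t} → s < t → t < suc n → f t ≢ f s) →
    IsPath G (f n) (f 0) (applyDownFrom f (suc n))
  applyDownFrom-isPath f n inG adjacent injective =
    refl , last-applyDownFrom f n , All.applyDownFrom⁺₁ f (suc n) inG ,
    subst (All (Edge G)) (sym (edgesOf-applyDownFrom f n)) (All.applyDownFrom⁺₁ _ n adjacent) ,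
    Unique.applyDownFrom⁺₁ f (suc n) injective

  record Route (A : Fin N → Set) (C : ℕ → Set) (u v : Fin N) : Set where
    constructor route
    field
      vertices      : List (Fin N)
      isRainbowPath : RainbowPath G c u v vertices
      verticesIn    : All A vertices
      coloursIn     : All C (pathColours c vertices)

  Route⇒∃RainbowPath : ∀ {A C u v} → Route A C u v → ∃ (RainbowPath G c u v)
  Route⇒∃RainbowPath (route ps path _ _) = ps , path

  Route-map : ∀ {A A′ C C′ u v} → A ⊆ A′ → C ⊆ C′ → Route A C u v → Route A′ C′ u v
  Route-map A⊆A′ C⊆C′ (route ps path inA inC) = route ps path (All.map A⊆A′ inA) (All.map C⊆C′ inC)

  Route-++ : ∀ {A B CA CB u w v} → Route A CA u w → Route B CB w v →
             A ∩ B ⊆ (_≡ w) → Empty (CA ∩ CB) → Route (A ∪ B) (CA ∪ CB) u v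
  Route-++ {CA = CA} {CB} (route P ((head≡u , last≡w , inG , edges , unique) , rainbow) inA inCA)
           (route (_ ∷ Q) ((refl , last≡v , _ ∷ inG′ , edges′ , w∉Q ∷ unique′) , rainbow′) (_ ∷ inB) inCB)
           meet apart =
    route (P ++ Q)
      ( ( head-++ P Q head≡u
        , trans (last-++ P Q last≡w) last≡v
        , All.++⁺ inG inG′
        , subst (All (Edge G)) (sym (edgesOf-++ P Q last≡w)) (All.++⁺ edges edges′)
        , Unique.++⁺ unique unique′ shared-vertices )
      , subst Unique (sym colours≡)
          (Unique.++⁺ rainbow rainbow′ (All-disjoint inCA inCB (λ a b → apart _ (a , b)))) )
      (All.++⁺ (All.map inj₁ inA) (All.map inj₂ inB))
      (subst (All (CA ∪ CB)) (sym colours≡) (All.++⁺ (All.map inj₁ inCA) (All.map inj₂ inCB)))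
    where
      colours≡ : pathColours c (P ++ Q) ≡ pathColours c P ++ pathColours c (_ ∷ Q)
      colours≡ = pathColours-++ c P Q last≡w
      shared-vertices : Disjoint P Q
      shared-vertices (y∈P , y∈Q) with meet (All.lookup inA y∈P , All.lookup inB y∈Q)
      ... | refl = All.lookup w∉Q y∈Q refl

IsPath-mono : ∀ {N} {G H : Graph N} {u v ps} → V H ⊆ˢ V G → (∀ {a b} → Adj H a b → Adj G a b) →
              IsPath H u v ps → IsPath G u v ps
IsPath-mono V⊆ E⊆ (head≡u , last≡v , inH , edges , unique) =
  head≡u , last≡v , All.map V⊆ inH , All.map E⊆ edges , unique

∣p∣+length≤∣q∣ : ∀ {N} {p q : Subset N} {xs : List (Fin N)} → p ⊆ˢ q →
                 Unique xs → All (_∈ˢ q) xs → All (_∉ˢ p) xs → ∣ p ∣ + length xs ≤ ∣ q ∣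
∣p∣+length≤∣q∣ {p = p} {q} {[]} p⊆q _ _ _ =
  subst (_≤ ∣ q ∣) (sym (+-identityʳ ∣ p ∣)) (p⊆q⇒∣p∣≤∣q∣ p⊆q)
∣p∣+length≤∣q∣ {p = p} {q} {a ∷ xs} p⊆q (a∉xs ∷ unique) (a∈q ∷ xs⊆q) (a∉p ∷ xs∉p) =
  subst (_≤ ∣ q ∣) (sym (+-suc ∣ p ∣ (length xs)))
    (≤-trans (+-monoˡ-≤ (length xs) ∣p∣<∣p+a∣) (∣p∣+length≤∣q∣ p+a⊆q unique xs⊆q xs∉p+a))
  where
    ∣p∣<∣p+a∣ : ∣ p ∣ < ∣ p ∪ˢ ⁅ a ⁆ ∣
    ∣p∣<∣p+a∣ = p⊂q⇒∣p∣<∣q∣ (p⊆p∪q ⁅ a ⁆ , a , x∈p∪q⁺ (inj₂ (x∈⁅x⁆ a)) , a∉p)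
    p+a⊆q : p ∪ˢ ⁅ a ⁆ ⊆ˢ q
    p+a⊆q y∈ with x∈p∪q⁻ p ⁅ a ⁆ y∈
    ... | inj₁ y∈p = p⊆q y∈p
    ... | inj₂ y∈a = subst (_∈ˢ q) (sym (x∈⁅y⁆⇒x≡y a y∈a)) a∈q
    xs∉p+a : All (_∉ˢ p ∪ˢ ⁅ a ⁆) xs
    xs∉p+a = All.zipWith (λ { (y∉p , a≢y) y∈ → case-∪ y∉p a≢y (x∈p∪q⁻ p ⁅ a ⁆ y∈) }) (xs∉p , a∉xs)
      where
        case-∪ : ∀ {y} → y ∉ˢ p → a ≢ y → y ∈ˢ p ⊎ y ∈ˢ ⁅ a ⁆ → ⊥
        case-∪ y∉p _   (inj₁ y∈p) = y∉p y∈p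
        case-∪ _   a≢y (inj₂ y∈a) = a≢y (sym (x∈⁅y⁆⇒x≡y a y∈a))

m+2n≤o⇒n≤[o∸m]/2 : ∀ {m n o} → m + 2 * n ≤ o → n ≤ (o ∸ m) / 2
m+2n≤o⇒n≤[o∸m]/2 {m} {n} {o} le = begin
  n             ≡⟨ sym (m*n/n≡m n 2) ⟩
  n * 2 / 2     ≡⟨ cong (_/ 2) (*-comm n 2) ⟩
  2 * n / 2     ≤⟨ /-mono-≤ (m+n≤o⇒m≤o∸n (2 * n) (subst (_≤ o) (+-comm m (2 * n)) le)) (≤-refl {2}) ⟩
  (o ∸ m) / 2   ∎
  where open ≤-Reasoning

module OddEar {N : ℕ} (G H : Graph N) (c : Colouring N) (csym : SymColouring c)
  (rcH : IsRainbowColouring H c) (k : ℕ) (x : ℕ → Fin N)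
  (ear : IsOddEar H k x) (union : IsUnionWithPath G H k x) (balanced : IsBalanced H c k x) where

  K : ℕ
  K = 2 * k + 1

  K≡1+k+k : K ≡ suc k + k
  K≡1+k+k = trans (+-comm (2 * k) 1) (cong (λ m → suc (k + m)) (+-identityʳ k))

  k<K : k < K
  k<K = subst (k <_) (sym K≡1+k+k) (s≤s (m≤m+n k k))

  x-injective : ∀ i j → i ≤ K → j ≤ K → x i ≡ x j → i ≡ j
  x-injective = proj₁ ear

  x₀∈H : x 0 ∈ˢ V H
  x₀∈H = proj₁ (proj₂ ear)

  x_K∈H : x K ∈ˢ V H
  x_K∈H = proj₁ (proj₂ (proj₂ ear))

  interior∉H : ∀ i → 0 < i → i < K → x i ∉ˢ V H
  interior∉H = proj₂ (proj₂ (proj₂ ear))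

  V-H⊆G : V H ⊆ˢ V G
  V-H⊆G v∈H = Equivalence.from (proj₁ union _) (inj₁ v∈H)

  Adj-H⊆G : ∀ {u v} → Adj H u v → Adj G u v
  Adj-H⊆G uv∈H = Equivalence.from (proj₂ union _ _) (inj₁ uv∈H)

  x∈G : ∀ {t} → t ≤ K → x t ∈ˢ V G
  x∈G {t} t≤K = Equivalence.from (proj₁ union (x t)) (inj₂ (t , t≤K , refl))

  ear-edge : ∀ {t} → t < K → Adj G (x (suc t)) (x t)
  ear-edge {t} t<K = Equivalence.from (proj₂ union _ _) (inj₂ (t , t<K , inj₂ (refl , refl)))

  ear∩H : ∀ {t} → t ≤ K → x t ∈ˢ V H → t ≡ 0 ⊎ t ≡ K
  ear∩H {zero}  _   _   = inj₁ refl
  ear∩H {suc t} 1+t≤K x∈H with m≤n⇒m<n∨m≡n 1+t≤K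
  ... | inj₁ t<K = ⊥-elim (interior∉H (suc t) z<s t<K x∈H)
  ... | inj₂ t≡K = inj₂ t≡K

  cs : ℕ → ℕ
  cs = proj₁ balanced

  cs-injective : ∀ i j → i < k → j < k → cs i ≡ cs j → i ≡ j
  cs-injective = proj₁ (proj₂ balanced)

  cs∉H : ∀ j → j < k → cs j ∉ colours H c
  cs∉H = proj₁ (proj₂ (proj₂ balanced))

  colour : ℕ → ℕ
  colour t = c (x (suc t)) (x t)

  colour-lower : ∀ {j} → j < k → colour j ≡ cs j
  colour-lower {j} j<k = trans (csym _ _) (proj₁ (proj₂ (proj₂ (proj₂ balanced))) j j<k)

  colour-middle : colour k ∈ colours H c
  colour-middle = subst (_∈ colours H c) (csym _ _) (proj₂ (proj₂ (proj₂ (proj₂ (proj₂ balanced)))))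

  colour-upper : ∀ {j} → j < k → colour (suc k + j) ≡ cs j
  colour-upper {j} j<k = begin
    c (x (suc (suc k + j))) (x (suc k + j))   ≡⟨ csym _ _ ⟩
    c (x (suc k + j)) (x (suc (suc k + j)))   ≡⟨ cong₂ (λ a b → c (x a) (x b)) (sym j+k+1≡1+k+j) (sym j+k+2≡2+k+j) ⟩
    c (x (j + k + 1)) (x (j + k + 2))         ≡⟨ proj₁ (proj₂ (proj₂ (proj₂ (proj₂ balanced)))) j j<k ⟩
    cs j                                      ∎
    where
      open ≡-Reasoning
      j+k+1≡1+k+j : j + k + 1 ≡ suc k + j
      j+k+1≡1+k+j = trans (+-comm (j + k) 1) (cong suc (+-comm j k))
      j+k+2≡2+k+j : j + k + 2 ≡ suc (suc k + j)
      j+k+2≡2+k+j = trans (+-comm (j + k) 2) (cong (λ n → suc (suc n)) (+-comm j k))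

  data EdgeKind : ℕ → Set where
    lower  : ∀ {j} → j < k → EdgeKind j
    middle : EdgeKind k
    upper  : ∀ {j} → j < k → EdgeKind (suc k + j)

  edgeKind : ∀ {t} → t < K → EdgeKind t
  edgeKind {t} t<K with <-cmp t k
  ... | tri< t<k _ _ = lower t<k
  ... | tri≈ _ refl _ = middle
  ... | tri> _ _ k<t = subst EdgeKind (m+[n∸m]≡n k<t) (upper j<k)
    where
      j<k : t ∸ suc k < k
      j<k = +-cancelˡ-< (suc k) _ _ (subst₂ _<_ (sym (m+[n∸m]≡n k<t)) K≡1+k+k t<K)

  colour-window : ∀ {s t} → s < t → t ≤ k + s → t < K → colour s ≢ colour t
  colour-window s<t t≤k+s t<K = distinct (edgeKind (<-trans s<t t<K)) (edgeKind t<K) s<t t≤k+s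
    where
      distinct : ∀ {s t} → EdgeKind s → EdgeKind t → s < t → t ≤ k + s → colour s ≢ colour t
      distinct (lower s<k) (lower t<k) s<t _ eq =
        <-irrefl (cs-injective _ _ s<k t<k (trans (sym (colour-lower s<k)) (trans eq (colour-lower t<k)))) s<t
      distinct (lower s<k) middle _ _ eq =
        cs∉H _ s<k (subst (_∈ colours H c) (trans (sym eq) (colour-lower s<k)) colour-middle)
      distinct (lower {j} j<k) (upper {j′} j′<k) _ t≤k+s eq
        with cs-injective j j′ j<k j′<k (trans (sym (colour-lower j<k)) (trans eq (colour-upper j′<k)))
      ... | refl = <-irrefl refl t≤k+s
      distinct middle (lower t<k) s<t _ _ = <-asym s<t t<k
      distinct middle middle s<t _ _ = <-irrefl refl s<t
      distinct middle (upper j<k) _ _ eq =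
        cs∉H _ j<k (subst (_∈ colours H c) (trans eq (colour-upper j<k)) colour-middle)
      distinct (upper {j} _) (lower t<k) s<t _ _ = <-asym (<-trans (s≤s (m≤m+n k j)) s<t) t<k
      distinct (upper {j} _) middle s<t _ _ = <-asym (s≤s (m≤m+n k j)) s<t
      distinct (upper {j} j<k) (upper {j′} j′<k) s<t _ eq
        with cs-injective j j′ j<k j′<k (trans (sym (colour-upper j<k)) (trans eq (colour-upper j′<k)))
      ... | refl = <-irrefl refl s<t

  open RainbowPaths G c

  OnEar : ℕ → ℕ → Fin N → Set
  OnEar lo hi y = ∃ λ t → lo ≤ t × t ≤ hi × y ≡ x t

  EarColour : ℕ → ℕ → ℕ → Set
  EarColour lo hi γ = ∃ λ t → lo ≤ t × t < hi × γ ≡ colour t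

  NewColour : ℕ → ℕ → ℕ → Set
  NewColour lo hi γ = ∃ λ j → lo ≤ j × j < hi × γ ≡ cs j

  segment : ∀ {b e} → b ≤ e → e ≤ K → e ∸ b ≤ suc k → Route (OnEar b e) (EarColour b e) (x e) (x b)
  segment {b} {e} b≤e e≤K e∸b≤1+k =
    subst (λ top → Route (OnEar b top) (EarColour b top) (x top) (x b)) (m∸n+n≡m b≤e)
      (descent (e ∸ b) (subst (_≤ K) (sym (m∸n+n≡m b≤e)) e≤K) e∸b≤1+k)
    where
      descent : ∀ n → n + b ≤ K → n ≤ suc k → Route (OnEar b (n + b)) (EarColour b (n + b)) (x (n + b)) (x b)
      descent n n+b≤K n≤1+k = route (applyDownFrom f (suc n)) (isPath , rainbow) onEar earColours
        where
          f : ℕ → Fin N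
          f t = x (t + b)
          t+b≤K : ∀ {t} → t < suc n → t + b ≤ K
          t+b≤K t<1+n = ≤-trans (+-monoˡ-≤ b (≤-pred t<1+n)) n+b≤K
          t+b<K : ∀ {t} → t < n → t + b < K
          t+b<K t<n = <-≤-trans (+-monoˡ-< b t<n) n+b≤K
          isPath : IsPath G (x (n + b)) (x b) (applyDownFrom f (suc n))
          isPath = applyDownFrom-isPath f n (λ t<1+n → x∈G (t+b≤K t<1+n)) (λ t<n → ear-edge (t+b<K t<n))
            λ {s} {t} s<t t<1+n eq →
              <-irrefl (sym (x-injective (t + b) (s + b) (t+b≤K t<1+n) (t+b≤K (<-trans s<t t<1+n)) eq)) (+-monoˡ-< b s<t)
          window : ∀ {s t} → t < n → t + b ≤ k + (s + b)
          window {s} t<n = ≤-trans (+-monoˡ-≤ b (≤-pred (<-≤-trans t<n n≤1+k))) (+-monoʳ-≤ k (m≤n+m b s))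
          rainbow : Rainbow c (applyDownFrom f (suc n))
          rainbow = subst Unique (sym (pathColours-applyDownFrom c f n))
            (Unique.applyDownFrom⁺₁ (λ t → colour (t + b)) n
              λ s<t t<n eq → colour-window (+-monoˡ-< b s<t) (window t<n) (t+b<K t<n) (sym eq))
          onEar : All (OnEar b (n + b)) (applyDownFrom f (suc n))
          onEar = All.applyDownFrom⁺₁ f (suc n) λ {t} t<1+n → t + b , m≤n+m b t , +-monoˡ-≤ b (≤-pred t<1+n) , refl
          earColours : All (EarColour b (n + b)) (pathColours c (applyDownFrom f (suc n)))
          earColours = subst (All (EarColour b (n + b))) (sym (pathColours-applyDownFrom c f n))
            (All.applyDownFrom⁺₁ _ n λ {t} t<n → t + b , m≤n+m b t , +-monoˡ-< b t<n , refl)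

  lowerSegment : ∀ {i} → i ≤ k → Route (OnEar 0 i) (NewColour 0 i) (x i) (x 0)
  lowerSegment {i} i≤k = Route-map (λ onEar → onEar) lowerColour (segment z≤n (≤-trans i≤k (<⇒≤ k<K)) (m≤n⇒m≤1+n i≤k))
    where
      lowerColour : EarColour 0 i ⊆ NewColour 0 i
      lowerColour (t , _ , t<i , refl) = t , z≤n , t<i , colour-lower (<-≤-trans t<i i≤k)

  upperSegment : ∀ {lo j} → lo + suc k ≤ j → j ≤ K → Route (OnEar j K) (NewColour lo k) (x K) (x j)
  upperSegment {lo} {j} lo+1+k≤j j≤K = Route-map (λ onEar → onEar) upperColour (segment j≤K ≤-refl K∸j≤1+k)
    where
      k<j : k < j
      k<j = ≤-trans (m≤n+m (suc k) lo) lo+1+k≤j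
      K∸j≤1+k : K ∸ j ≤ suc k
      K∸j≤1+k = m≤n⇒m≤1+n (≤-trans (∸-monoʳ-≤ K k<j) (≤-reflexive (trans (cong (_∸ suc k) K≡1+k+k) (m+n∸m≡n (suc k) k))))
      kindColour : ∀ {t} → EdgeKind t → j ≤ t → NewColour lo k (colour t)
      kindColour (lower t<k)       j≤t = ⊥-elim (<-asym (≤-trans k<j j≤t) t<k)
      kindColour middle            j≤t = ⊥-elim (<-irrefl refl (≤-trans k<j j≤t))
      kindColour (upper {j′} j′<k) j≤t =
        j′ , +-cancelˡ-≤ (suc k) lo j′ (subst (_≤ suc k + j′) (+-comm lo (suc k)) (≤-trans lo+1+k≤j j≤t)) , j′<k , colour-upper j′<k
      upperColour : EarColour j K ⊆ NewColour lo k
      upperColour (t , j≤t , t<K , refl) = kindColour (edgeKind t<K) j≤t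

  H-route : ∀ {u v} → u ∈ˢ V H → v ∈ˢ V H → Route (_∈ˢ V H) (_∈ colours H c) u v
  H-route u∈H v∈H with proj₂ rcH _ _ u∈H v∈H
  ... | ps , path@(_ , _ , inH , edges , _) , rainbow =
    route ps (IsPath-mono {G = G} {H = H} V-H⊆G Adj-H⊆G path , rainbow) inH
      (All.map⁺ (All.map (RainbowPaths.∈-colours⁺ H c) edges))

  lower∩H : ∀ {i} → i ≤ k → OnEar 0 i ∩ (_∈ˢ V H) ⊆ (_≡ x 0)
  lower∩H i≤k ((t , _ , t≤i , refl) , x∈H) with ear∩H (≤-trans t≤i (≤-trans i≤k (<⇒≤ k<K))) x∈H
  ... | inj₁ refl = refl
  ... | inj₂ refl = ⊥-elim (<⇒≱ k<K (≤-trans t≤i i≤k))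

  H∩upper : ∀ {j} → k < j → (_∈ˢ V H) ∩ OnEar j K ⊆ (_≡ x K)
  H∩upper k<j (x∈H , (t , j≤t , t≤K , refl)) with ear∩H t≤K x∈H
  ... | inj₁ refl = ⊥-elim (n≮0 (≤-trans k<j j≤t))
  ... | inj₂ refl = refl

  lowerH∩upper : ∀ {i j} → i < j → k < j → (OnEar 0 i ∪ (_∈ˢ V H)) ∩ OnEar j K ⊆ (_≡ x K)
  lowerH∩upper i<j _ (inj₁ (t , _ , t≤i , refl) , (t′ , j≤t′ , t′≤K , eq)) =
    ⊥-elim (<-irrefl (x-injective t t′ (≤-trans (<⇒≤ t<t′) t′≤K) t′≤K eq) t<t′)
    where
      t<t′ : t < t′
      t<t′ = <-≤-trans (≤-<-trans t≤i i<j) j≤t′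
  lowerH∩upper _ k<j (inj₂ x∈H , onUpper) = H∩upper k<j (x∈H , onUpper)

  lower-apart-H : ∀ {i} → i ≤ k → Empty (NewColour 0 i ∩ (_∈ colours H c))
  lower-apart-H i≤k _ ((j , _ , j<i , refl) , inH) = cs∉H j (<-≤-trans j<i i≤k) inH

  H-apart-upper : ∀ {lo} → Empty ((_∈ colours H c) ∩ NewColour lo k)
  H-apart-upper _ (inH , (j , _ , j<k , refl)) = cs∉H j j<k inH

  lowerH-apart-upper : ∀ {i} → Empty ((NewColour 0 i ∪ (_∈ colours H c)) ∩ NewColour i k)
  lowerH-apart-upper _ (inj₁ (j , _ , j<i , refl) , (j′ , i≤j′ , j′<k , eq)) =
    <-irrefl (cs-injective j j′ (<-trans j<j′ j′<k) j′<k eq) j<j′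
    where
      j<j′ : j < j′
      j<j′ = <-≤-trans j<i i≤j′
  lowerH-apart-upper γ (inj₂ inH , new) = H-apart-upper γ (inH , new)

  ear→H : ∀ {i v} → i < K → v ∈ˢ V H → ∃ (RainbowPath G c (x i) v)
  ear→H {i} i<K v∈H with i ≤? k
  ... | yes i≤k = Route⇒∃RainbowPath
        (Route-++ (lowerSegment i≤k) (H-route x₀∈H v∈H) (lower∩H i≤k) (lower-apart-H i≤k))
  ... | no i≰k = ∃RainbowPath-sym csym (Route⇒∃RainbowPath
        (Route-++ (H-route v∈H x_K∈H) (upperSegment {lo = 0} (≰⇒> i≰k) (<⇒≤ i<K)) (H∩upper (≰⇒> i≰k)) H-apart-upper))

  ear→ear : ∀ {i j} → i ≤ j → j < K → ∃ (RainbowPath G c (x i) (x j))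
  ear→ear {i} {j} i≤j j<K with j ≤? i + suc k
  ... | yes near = ∃RainbowPath-sym csym (Route⇒∃RainbowPath (segment i≤j (<⇒≤ j<K) (m≤n+o⇒m∸n≤o j i near)))
  ... | no far = Route⇒∃RainbowPath
        (Route-++ (Route-++ (lowerSegment i≤k) (H-route x₀∈H x_K∈H) (lower∩H i≤k) (lower-apart-H i≤k))
                  (upperSegment (<⇒≤ i+1+k<j) (<⇒≤ j<K)) (lowerH∩upper i<j k<j) lowerH-apart-upper)
    where
      i+1+k<j : i + suc k < j
      i+1+k<j = ≰⇒> far
      i<j : i < j
      i<j = ≤-<-trans (m≤m+n i (suc k)) i+1+k<j
      k<j : k < j
      k<j = <-trans (≤-<-trans (m≤n+m k i) (+-monoʳ-< i (n<1+n k))) i+1+k<j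
      i≤k : i ≤ k
      i≤k = <⇒≤ (+-cancelʳ-< (suc k) i k (subst (i + suc k <_) (trans K≡1+k+k (+-comm (suc k) k)) (<-trans i+1+k<j j<K)))

  vertex-cases : ∀ {u} → u ∈ˢ V G → u ∈ˢ V H ⊎ ∃ λ i → i < K × u ≡ x i
  vertex-cases u∈G with Equivalence.to (proj₁ union _) u∈G
  ... | inj₁ u∈H = inj₁ u∈H
  ... | inj₂ (i , i≤K , refl) with m≤n⇒m<n∨m≡n i≤K
  ...   | inj₁ i<K  = inj₂ (i , i<K , refl)
  ...   | inj₂ refl = inj₁ x_K∈H

  rainbowConnected : ∀ u v → u ∈ˢ V G → v ∈ˢ V G → ∃ (RainbowPath G c u v)
  rainbowConnected u v u∈G v∈G with vertex-cases u∈G | vertex-cases v∈G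
  ... | inj₁ u∈H              | inj₁ v∈H              = Route⇒∃RainbowPath (H-route u∈H v∈H)
  ... | inj₂ (i , i<K , refl) | inj₁ v∈H              = ear→H i<K v∈H
  ... | inj₁ u∈H              | inj₂ (j , j<K , refl) = ∃RainbowPath-sym csym (ear→H j<K u∈H)
  ... | inj₂ (i , i<K , refl) | inj₂ (j , j<K , refl) with ≤-total i j
  ...   | inj₁ i≤j = ear→ear i≤j j<K
  ...   | inj₂ j≤i = ∃RainbowPath-sym csym (ear→ear j≤i i<K)

  isRainbowColouring : IsRainbowColouring G c
  isRainbowColouring = rainbowConnected⇒IsRainbowColouring rainbowConnected

  palette : List ℕ
  palette = colours H c ++ applyUpTo cs k

  colour∈palette : ∀ {t} → t < K → colour t ∈ palette
  colour∈palette t<K = kindColour (edgeKind t<K)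
    where
      kindColour : ∀ {t} → EdgeKind t → colour t ∈ palette
      kindColour (lower t<k) = subst (_∈ palette) (sym (colour-lower t<k)) (∈-++⁺ʳ (colours H c) (∈-applyUpTo⁺ cs t<k))
      kindColour middle      = ∈-++⁺ˡ colour-middle
      kindColour (upper j<k) = subst (_∈ palette) (sym (colour-upper j<k)) (∈-++⁺ʳ (colours H c) (∈-applyUpTo⁺ cs j<k))

  colours-G⊆ : ∀ {γ} → γ ∈ colours G c → γ ∈ palette
  colours-G⊆ γ∈ with ∈-colours⁻ γ∈
  ... | u , v , uv∈G , refl with Equivalence.to (proj₂ union u v) uv∈G
  ... | inj₁ uv∈H                           = ∈-++⁺ˡ (RainbowPaths.∈-colours⁺ H c uv∈H)
  ... | inj₂ (t , t<K , inj₁ (refl , refl)) = subst (_∈ palette) (csym _ _) (colour∈palette t<K)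
  ... | inj₂ (t , t<K , inj₂ (refl , refl)) = colour∈palette t<K

  colours-count : length (colours G c) ≤ length (colours H c) + k
  colours-count = begin
    length (colours G c)                               ≤⟨ Unique⇒length≤ colours-unique colours-G⊆ ⟩
    length palette                                     ≡⟨ length-++ (colours H c) ⟩
    length (colours H c) + length (applyUpTo cs k)     ≡⟨ cong (length (colours H c) +_) (length-applyUpTo cs k) ⟩
    length (colours H c) + k                           ∎
    where open ≤-Reasoning

  vertex-count : ∣ V H ∣ + 2 * k ≤ ∣ V G ∣
  vertex-count =
    subst (λ n → ∣ V H ∣ + n ≤ ∣ V G ∣) (length-applyUpTo interior (2 * k))
      (∣p∣+length≤∣q∣ V-H⊆G
        (Unique.applyUpTo⁺₁ interior (2 * k) λ i<j j<2k eq →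
          <-irrefl (suc-injective (x-injective _ _ (<⇒≤ (1+<K (<-trans i<j j<2k))) (<⇒≤ (1+<K j<2k)) eq)) i<j)
        (All.applyUpTo⁺₁ interior (2 * k) λ t<2k → x∈G (<⇒≤ (1+<K t<2k)))
        (All.applyUpTo⁺₁ interior (2 * k) λ t<2k → interior∉H _ z<s (1+<K t<2k)))
    where
      interior : ℕ → Fin N
      interior t = x (suc t)
      1+<K : ∀ {t} → t < 2 * k → suc t < K
      1+<K t<2k = <-≤-trans (s≤s t<2k) (≤-reflexive (+-comm 1 (2 * k)))

lemma5 : ∀ {N : ℕ} (G H : Graph N) (c : Colouring N) (h k : ℕ) (x : ℕ → Fin N)
    → SymColouring c
    → IsRainbowColouring H c
    → length (colours H c) ≤ h
    → IsOddEar H k x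
    → IsUnionWithPath G H k x
    → IsBalanced H c k x
    → IsRainbowColouring G c × RcAtMost G (h + (∣ V G ∣ ∸ ∣ V H ∣) / 2)
lemma5 G H c h k x csym rcH ∣colours-H∣≤h ear union balanced =
  isRainbowColouring , c , csym , isRainbowColouring , (begin
    length (colours G c)              ≤⟨ colours-count ⟩
    length (colours H c) + k          ≤⟨ +-mono-≤ ∣colours-H∣≤h (m+2n≤o⇒n≤[o∸m]/2 {∣ V H ∣} vertex-count) ⟩
    h + (∣ V G ∣ ∸ ∣ V H ∣) / 2       ∎)
  where
    open OddEar G H c csym rcH k x ear union balanced
    open ≤-Reasoning
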